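{- Let $G$ be a finite simple graph and let $t\in\{1,\ldots,\mathrm{pw}(G)+1\}$ be an integer. Then there exist an interval supergraph $G'$ of $G$ and a canonical interval representation $\mathcal{I}'$ of $G'$ such that \[\mathrm{wid}(\mathcal{I}')\leq\left(1+\frac{2}{t}\right)(\mathrm{pw}(G)+1)\qquad\text{and}\qquad \mathrm{icost}(\mathcal{I}')\leq (t+2)\,\mathrm{prof}(G).\]
   Context: All graphs are finite and simple. A graph $G'$ is a supergraph of $G$ if $V(G)\subseteq V(G')$ and $E(G)\subseteq E(G')$. Pathwidth: a path decomposition of $G$ is a sequence $(X_1,\ldots,X_d)$ of subsets of $V(G)$ with $\bigcup_i X_i=V(G)$, every edge contained in some $X_i$, and $X_i\cap X_k\subseteq X_j$ whenever $i\le j\le k$; its width is $\max_i|X_i|-1$, and $\mathrm{pw}(G)$ is the minimum width of a path decomposition of $G$. Profile: for a bijection $f\colon V(G)\to\{1,\ldots,|V(G)|\}$, $\mathrm{prof}_f(G)=\sum_{v\in V(G)}\bigl(f(v)-\min_{u\in\{v\}\cup N_G(v)}f(u)\bigr)$, and $\mathrm{prof}(G)$ is the minimum of $\mathrm{prof}_f(G)$ over all such bijections $f$. Interval representations: $G$ is an interval graph if each vertex $v$ can be assigned an open interval $I_v=(l_v,r_v)$ of the real line so that $\{u,v\}\in E(G)$ iff $I_u\cap I_v\ne\emptyset$ (for $u\neq v$); the collection $\mathcal{I}$ of these intervals is an interval representation, and $\mathcal{I}(v)$ denotes the interval of $v$. With $n=|V(G)|$, $\mathcal{I}$ is canonical if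 all endpoints are integers and $\{l_v : v\in V(G)\}=\{1,\ldots,n\}$. For a real $x$, $m_x(\mathcal{I})$ is the number of intervals of $\mathcal{I}$ containing the point $x$. The width is $\mathrm{wid}(\mathcal{I})=\max_{x\in\mathbb{R}}m_x(\mathcal{I})$. Writing the intervals as $I_1,\ldots,I_n$ and $f_i(\mathcal{I})=m_{l(I_i)}(\mathcal{I})$ where $l(I_i)$ is the left endpoint of $I_i$ (so $I_i$ itself, being open, is not counted), the interval cost is $\mathrm{icost}(\mathcal{I})=\sum_{i=1}^n f_i(\mathcal{I})$ (this equals the number of edges of the represented graph). -}

module Defs where

open import Data.Nat using (ℕ; zero; suc; _+_; _*_; _≤_; _<_; _⊓_)
open import Data.Bool using (Bool; true; false; if_then_else_; _∨_)
open import Data.Fin using (Fin; toℕ) renaming (zero to fzero; suc to fsuc)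
open import Data.Fin.Subset using (Subset; _∈_; _⊆_; _∩_; ∣_∣)
open import Data.Integer using (+_)
open import Data.Rational using (ℚ; _/_) renaming (_<_ to _<ℚ_)
open import Data.Rational.Properties using () renaming (_<?_ to _<ℚ?_)
open import Data.Product using (Σ; ∃; _×_)
open import Data.Sum using (_⊎_)
open import Function using (_∘_; _⇔_)
open import Function.Definitions using (Bijective)
open import Relation.Binary.PropositionalEquality using (_≡_; _≢_)
open import Relation.Nullary using (¬_)
open import Relation.Nullary.Decidable using (⌊_⌋; _×-dec_)
open import Data.Fin using (_≟_)

record Graph (n : ℕ) : Set where
  field
    adj     : Fin n → Fin n → Bool
    adj-sym : ∀ u v → adj u v ≡ adj v u
    adj-irr : ∀ v → adj v v ≡ false
open Graph public

Edge : ∀ {n} → Graph n → Fin n → Fin n → Set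
Edge G u v = adj G u v ≡ true

-- G' (on Fin m) is a supergraph of G (on Fin n), the vertex inclusion
-- V(G) ⊆ V(G') being given by an injective map ι.
IsSupergraphVia : ∀ {n m} → Graph n → Graph m → (Fin n → Fin m) → Set
IsSupergraphVia G G' ι =
  (∀ u v → ι u ≡ ι v → u ≡ v) × (∀ u v → Edge G u v → Edge G' (ι u) (ι v))

sumFin : ∀ {n} → (Fin n → ℕ) → ℕ
sumFin {zero}  g = 0
sumFin {suc n} g = g fzero + sumFin (g ∘ fsuc)

countFin : ∀ {n} → (Fin n → Bool) → ℕ
countFin S = sumFin (λ i → if S i then 1 else 0)

minSel : ∀ {n} → (Fin n → Bool) → (Fin n → ℕ) → ℕ → ℕ
minSel {zero}  S g a = a
minSel {suc n} S g a = minSel (S ∘ fsuc) (g ∘ fsuc) (if S fzero then a ⊓ g fzero else a)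

record PathDecomposition {n : ℕ} (G : Graph n) : Set where
  field
    len      : ℕ
    bag      : Fin len → Subset n
    covers   : ∀ v → Σ (Fin len) λ i → v ∈ bag i
    edgesIn  : ∀ u v → Edge G u v → Σ (Fin len) λ i → (u ∈ bag i) × (v ∈ bag i)
    interpol : ∀ i j k → toℕ i ≤ toℕ j → toℕ j ≤ toℕ k →
               (bag i ∩ bag k) ⊆ bag j
open PathDecomposition public

WidthPlusOneAtMost : ∀ {n} {G : Graph n} → PathDecomposition G → ℕ → Set
WidthPlusOneAtMost D s = ∀ i → ∣ bag D i ∣ ≤ s

IsPathwidthPlusOne : ∀ {n} → Graph n → ℕ → Set
IsPathwidthPlusOne G k =
  (Σ (PathDecomposition G) λ D → WidthPlusOneAtMost D k) ×
  (∀ (D : PathDecomposition G) s → WidthPlusOneAtMost D s → k ≤ s)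

-- Profile (layouts f : V → {0,…,n-1}; the shift by one is irrelevant)

closedNbr : ∀ {n} → Graph n → Fin n → Fin n → Bool
closedNbr G v u = ⌊ u ≟ v ⌋ ∨ adj G v u

profOf : ∀ {n} → Graph n → (Fin n → Fin n) → ℕ
profOf G f = sumFin (λ v →
  toℕ (f v) Data.Nat.∸ minSel (closedNbr G v) (toℕ ∘ f) (toℕ (f v)))

IsProfile : ∀ {n} → Graph n → ℕ → Set
IsProfile {n} G q =
  (Σ (Fin n → Fin n) λ f → Bijective _≡_ _≡_ f × profOf G f ≡ q) ×
  (∀ (f : Fin n → Fin n) → Bijective _≡_ _≡_ f → q ≤ profOf G f)

-- Interval representations with natural-number endpoints
-- I(v) = open interval (left v , right v), nonempty.

record IntervalRep (m : ℕ) : Set where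
  field
    left     : Fin m → ℕ
    right    : Fin m → ℕ
    nonempty : ∀ v → left v < right v
open IntervalRep public

ℕ→ℚ : ℕ → ℚ
ℕ→ℚ k = + k / 1

InInterval : ∀ {m} → IntervalRep m → Fin m → ℚ → Set
InInterval I v x = (ℕ→ℚ (left I v) <ℚ x) × (x <ℚ ℕ→ℚ (right I v))

Represents : ∀ {m} → IntervalRep m → Graph m → Set
Represents I G = ∀ u v → u ≢ v →
  (Edge G u v ⇔ (∃ λ (x : ℚ) → InInterval I u x × InInterval I v x))

-- endpoints integral (built in), and {l_v} = {1,…,m}
Canonical : ∀ {m} → IntervalRep m → Set
Canonical {m} I =
  (∀ v → 1 ≤ left I v × left I v ≤ m) ×
  (∀ k → 1 ≤ k → k ≤ m → Σ (Fin m) λ v → left I v ≡ k)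

mult : ∀ {m} → IntervalRep m → ℚ → ℕ
mult I x = countFin (λ v →
  ⌊ (ℕ→ℚ (left I v) <ℚ? x) ×-dec (x <ℚ? ℕ→ℚ (right I v)) ⌋)

icost : ∀ {m} → IntervalRep m → ℕ
icost I = sumFin (λ i → mult I (ℕ→ℚ (left I i)))

-- Fix an order of the vertices and give each vertex the interval from its own position to
-- that of its last neighbour: this is a canonical interval supergraph in which the
-- intervals through a point, or through the left end of the interval of w, lie in
-- {w} ∪ ∂(vertices before w), where ∂ T is the set of vertices of T with a neighbour
-- outside T. Ordering by first bag of a path decomposition of width p1 - 1 keeps every
-- such boundary below p1, while the suffixes of an optimal layout f have boundaries whose
-- sizes sum to at most prof(G). Cut f at the checkpoints j with t·|∂(suffix j)| ≤ p1 and
-- list the blocks between consecutive checkpoints from last to first, each block ordered by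
-- first bag. A prefix boundary then lies in the boundaries of two checkpoint suffixes and of
-- one first-bag prefix, so t·(1 + |∂|) ≤ (t + 2)·p1. A vertex other than the first one of
-- its block sits at a position j that is not a checkpoint, so p1 < t·|∂(suffix j)| pays for
-- its whole cost within (t + 2)·|∂(suffix j)|; the first vertex only sees the suffix after
-- the block, whose boundary is paid by the vertex at the next checkpoint.

module Submission where

open import Defs
open import Data.Bool using (Bool; true; false; if_then_else_; _∨_)
open import Data.Bool.Properties using (∨-zeroʳ) renaming (_≟_ to _≟ᵇ_)
open import Data.Empty using (⊥-elim)
open import Data.Fin using (Fin; toℕ; fromℕ<; punchOut; _≟_) renaming (zero to fzero; suc to fsuc)
open import Data.Fin.Properties as Finₚ using (toℕ<n; toℕ-injective; toℕ-fromℕ<; punchOut-injective; injective⇒≤)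
open import Data.Fin.Subset using (Subset; _∈_; ∣_∣)
open import Data.Fin.Subset.Properties using (x∈p∩q⁺)
import Data.Integer as ℤ
import Data.Integer.Properties as ℤ
open import Data.Nat using (ℕ; zero; suc; _+_; _*_; _∸_; _≤_; _<_; _⊔_; z≤n; s≤s; _≤?_; _<?_) renaming (_≟_ to _≟ℕ_)
open import Data.Nat.Properties hiding (_≟_)
open import Algebra.Properties.CommutativeSemigroup +-commutativeSemigroup using (interchange)
open import Data.Nat.Coprimality using (1-coprimeTo) renaming (sym to coprime-sym)
open import Data.Nat.Tactic.RingSolver using (solve-∀)
open import Data.Product using (Σ; ∃; _×_; _,_; proj₁; proj₂)
open import Data.Rational as ℚ using (ℚ; mkℚ; *<*; *≤*)
open import Data.Rational.Properties as ℚ using (normalize-coprime; drop-*<*; <-dense) renaming (_<?_ to _<ℚ?_)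
open import Data.Sum as Sum using (_⊎_; inj₁; inj₂; [_,_]′)
open import Data.Vec using (lookup; _∷_; [])
open import Data.Vec.Properties using ([]=⇒lookup; lookup⇒[]=)
open import Function using (_∘_; _⇔_; mk⇔; Equivalence)
open import Function.Definitions using (Injective)
open import Relation.Binary.Definitions using (tri<; tri≈; tri>)
open import Relation.Binary.PropositionalEquality using (_≡_; _≢_; refl; sym; trans; cong; cong₂; subst; subst₂)
open import Relation.Nullary using (¬_; Dec; yes; no)
open import Relation.Unary using (Decidable)
open import Relation.Nullary.Decidable using (⌊_⌋; _×-dec_; ¬?; toSum)

private variable
  A : Set
  m n : ℕ

⌊⌋-true : (a? : Dec A) → A → ⌊ a? ⌋ ≡ true
⌊⌋-true (yes _) _ = refl
⌊⌋-true (no ¬a) a = ⊥-elim (¬a a)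

⌊⌋-false : (a? : Dec A) → ¬ A → ⌊ a? ⌋ ≡ false
⌊⌋-false (yes a) ¬a = ⊥-elim (¬a a)
⌊⌋-false (no _)  _  = refl

⌊⌋-true⁻¹ : (a? : Dec A) → ⌊ a? ⌋ ≡ true → A
⌊⌋-true⁻¹ (yes a) _ = a

⌊⌋-⇔ : {B : Set} → A ⇔ B → (a? : Dec A) (b? : Dec B) → ⌊ a? ⌋ ≡ ⌊ b? ⌋
⌊⌋-⇔ A⇔B (yes a) b? = sym (⌊⌋-true b? (Equivalence.to A⇔B a))
⌊⌋-⇔ A⇔B (no ¬a) b? = sym (⌊⌋-false b? (¬a ∘ Equivalence.from A⇔B))

true≢false : true ≢ false
true≢false ()

𝟙 : Bool → ℕ
𝟙 b = if b then 1 else 0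

sumFin-cong : {g h : Fin n → ℕ} → (∀ i → g i ≡ h i) → sumFin g ≡ sumFin h
sumFin-cong {zero}  e = refl
sumFin-cong {suc n} e = cong₂ _+_ (e fzero) (sumFin-cong (e ∘ fsuc))

sumFin-mono : {g h : Fin n → ℕ} → (∀ i → g i ≤ h i) → sumFin g ≤ sumFin h
sumFin-mono {zero}  le = z≤n
sumFin-mono {suc n} le = +-mono-≤ (le fzero) (sumFin-mono (le ∘ fsuc))

sumFin-zero : (g : Fin n → ℕ) → (∀ i → g i ≡ 0) → sumFin g ≡ 0
sumFin-zero {zero}  g e = refl
sumFin-zero {suc n} g e rewrite e fzero = sumFin-zero (g ∘ fsuc) (e ∘ fsuc)

sumFin-+ : (g h : Fin n → ℕ) → sumFin (λ i → g i + h i) ≡ sumFin g + sumFin h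
sumFin-+ {zero}  g h = refl
sumFin-+ {suc n} g h rewrite sumFin-+ (g ∘ fsuc) (h ∘ fsuc) = interchange (g fzero) (h fzero) _ _

sumFin-*ʳ : (g : Fin n → ℕ) (c : ℕ) → sumFin (λ i → g i * c) ≡ sumFin g * c
sumFin-*ʳ {zero}  g c = refl
sumFin-*ʳ {suc n} g c rewrite sumFin-*ʳ (g ∘ fsuc) c = sym (*-distribʳ-+ c (g fzero) _)

sumFin-*ˡ : (c : ℕ) (g : Fin n → ℕ) → sumFin (λ i → c * g i) ≡ c * sumFin g
sumFin-*ˡ {zero}  c g = sym (*-zeroʳ c)
sumFin-*ˡ {suc n} c g rewrite sumFin-*ˡ c (g ∘ fsuc) = sym (*-distribˡ-+ c (g fzero) _)

sumFin-comm : (F : Fin n → Fin m → ℕ) →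
  sumFin (λ i → sumFin (λ j → F i j)) ≡ sumFin (λ j → sumFin (λ i → F i j))
sumFin-comm {zero}  {m} F = sym (sumFin-zero {m} (λ _ → 0) (λ _ → refl))
sumFin-comm {suc n} {m} F rewrite sumFin-comm (F ∘ fsuc) =
  sym (sumFin-+ (F fzero) (λ j → sumFin (λ i → F (fsuc i) j)))

term≤sumFin : (g : Fin n → ℕ) (i : Fin n) → g i ≤ sumFin g
term≤sumFin g fzero    = m≤m+n (g fzero) _
term≤sumFin g (fsuc i) = ≤-trans (term≤sumFin (g ∘ fsuc) i) (m≤n+m _ (g fzero))

𝟙-mono : {a b : Bool} → (a ≡ true → b ≡ true) → 𝟙 a ≤ 𝟙 b
𝟙-mono {false} h = z≤n
𝟙-mono {true}  h rewrite h refl = ≤-refl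

countFin-mono : {S T : Fin n → Bool} → (∀ i → S i ≡ true → T i ≡ true) → countFin S ≤ countFin T
countFin-mono S⊆T = sumFin-mono (λ i → 𝟙-mono (S⊆T i))

countFin-< : {S T : Fin n → Bool} → (∀ i → S i ≡ true → T i ≡ true) →
  ∀ w → T w ≡ true → S w ≡ false → countFin S < countFin T
countFin-< {suc n} {S} {T} S⊆T fzero Tw Sw rewrite Tw | Sw = s≤s (countFin-mono (S⊆T ∘ fsuc))
countFin-< {suc n} {S} {T} S⊆T (fsuc w) Tw Sw =
  ≤-trans (≤-reflexive (sym (+-suc (𝟙 (S fzero)) _)))
    (+-mono-≤ (𝟙-mono (S⊆T fzero)) (countFin-< (S⊆T ∘ fsuc) w Tw Sw))

countFin-all : countFin {n} (λ _ → true) ≡ n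
countFin-all {zero}  = refl
countFin-all {suc n} = cong suc countFin-all

countFin-subsingleton : (S : Fin n → Bool) → (∀ i j → S i ≡ true → S j ≡ true → i ≡ j) → countFin S ≤ 1
countFin-subsingleton {zero}  S unique = z≤n
countFin-subsingleton {suc n} S unique with S fzero in e
... | false = countFin-subsingleton (S ∘ fsuc) (λ i j Si Sj → Finₚ.suc-injective (unique _ _ Si Sj))
... | true  = ≤-reflexive (cong suc (sumFin-zero _ rest-empty))
  where
  rest-empty : ∀ i → 𝟙 (S (fsuc i)) ≡ 0
  rest-empty i with S (fsuc i) in e′
  ... | false = refl
  ... | true with unique fzero (fsuc i) e e′
  ... | ()

countFin-∪ : {S T U : Fin n → Bool} → (∀ i → S i ≡ true → T i ≡ true ⊎ U i ≡ true) →
  countFin S ≤ countFin T + countFin U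
countFin-∪ {S = S} {T} {U} S⊆T∪U =
  ≤-trans (sumFin-mono pointwise) (≤-reflexive (sumFin-+ (𝟙 ∘ T) (𝟙 ∘ U)))
  where
  pointwise : ∀ i → 𝟙 (S i) ≤ 𝟙 (T i) + 𝟙 (U i)
  pointwise i with S i in e
  ... | false = z≤n
  ... | true with S⊆T∪U i e
  ... | inj₁ Ti rewrite Ti = s≤s z≤n
  ... | inj₂ Ui rewrite Ui = m≤n+m 1 (𝟙 (T i))

sumOn : (Fin n → Bool) → (Fin n → ℕ) → ℕ
sumOn P g = sumFin (λ w → 𝟙 (P w) * g w)

sumOn-+ : (Q R : Fin n → Bool) (g : Fin n → ℕ) →
  sumOn Q g + sumOn R g ≡ sumFin (λ w → (𝟙 (Q w) + 𝟙 (R w)) * g w)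
sumOn-+ Q R g = trans (sym (sumFin-+ (λ w → 𝟙 (Q w) * g w) (λ w → 𝟙 (R w) * g w))) (sumFin-cong λ w → sym (*-distribʳ-+ (g w) (𝟙 (Q w)) (𝟙 (R w))))

sumOn-partition : (P Q R : Fin n → Bool) (g : Fin n → ℕ) → (∀ w → 𝟙 (P w) ≡ 𝟙 (Q w) + 𝟙 (R w)) →
  sumOn P g ≡ sumOn Q g + sumOn R g
sumOn-partition P Q R g split = trans (sumFin-cong λ w → cong (_* g w) (split w)) (sym (sumOn-+ Q R g))

sumOn-disjoint : (P Q R : Fin n → Bool) (g : Fin n → ℕ) → (∀ w → 𝟙 (Q w) + 𝟙 (R w) ≤ 𝟙 (P w)) →
  sumOn Q g + sumOn R g ≤ sumOn P g
sumOn-disjoint P Q R g disjoint = ≤-trans (≤-reflexive (sumOn-+ Q R g)) (sumFin-mono λ w → *-monoˡ-≤ (g w) (disjoint w))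

sumOn-mono : (P : Fin n → Bool) {g h : Fin n → ℕ} → (∀ w → P w ≡ true → g w ≤ h w) → sumOn P g ≤ sumOn P h
sumOn-mono P {g} {h} g≤h = sumFin-mono pointwise
  where
  pointwise : ∀ w → 𝟙 (P w) * g w ≤ 𝟙 (P w) * h w
  pointwise w with P w in Pw
  ... | false = z≤n
  ... | true  = +-monoˡ-≤ 0 (g≤h w Pw)

sumOn-const : (P : Fin n → Bool) (c : ℕ) → sumOn P (λ _ → c) ≡ countFin P * c
sumOn-const P c = sumFin-*ʳ (𝟙 ∘ P) c

sumOn-empty : (P : Fin n → Bool) (g : Fin n → ℕ) → (∀ w → P w ≡ false) → sumOn P g ≡ 0
sumOn-empty P g empty = sumFin-zero _ λ w → cong (λ b → 𝟙 b * g w) (empty w)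

sumOn-full : (P : Fin n → Bool) (g : Fin n → ℕ) → (∀ w → P w ≡ true) → sumOn P g ≡ sumFin g
sumOn-full P g full = sumFin-cong λ w → trans (cong (λ b → 𝟙 b * g w) (full w)) (+-identityʳ (g w))

countFin-∪₃ : {S T U V : Fin n → Bool} →
  (∀ i → S i ≡ true → T i ≡ true ⊎ U i ≡ true ⊎ V i ≡ true) →
  countFin S ≤ countFin T + (countFin U + countFin V)
countFin-∪₃ {S = S} {T} {U} {V} cover = ≤-trans (sumFin-mono pointwise)
  (≤-reflexive (trans (sumFin-+ (𝟙 ∘ T) _) (cong (countFin T +_) (sumFin-+ (𝟙 ∘ U) (𝟙 ∘ V)))))
  where
  pointwise : ∀ i → 𝟙 (S i) ≤ 𝟙 (T i) + (𝟙 (U i) + 𝟙 (V i))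
  pointwise i with S i in Si
  ... | false = z≤n
  ... | true with cover i Si
  ... | inj₁ Ti        rewrite Ti = s≤s z≤n
  ... | inj₂ (inj₁ Ui) rewrite Ui = ≤-trans (m≤m+n 1 (𝟙 (V i))) (m≤n+m _ (𝟙 (T i)))
  ... | inj₂ (inj₂ Vi) rewrite Vi = ≤-trans (m≤n+m _ (𝟙 (U i))) (m≤n+m _ (𝟙 (T i)))

x+[x+t*x]≡[t+2]*x : ∀ t x → x + (x + t * x) ≡ (t + 2) * x
x+[x+t*x]≡[t+2]*x = solve-∀

x≤[t+2]*x : ∀ t x → x ≤ (t + 2) * x
x≤[t+2]*x t x = ≤-trans (m≤m+n x (x + t * x)) (≤-reflexive (x+[x+t*x]≡[t+2]*x t x))

argmax : (P : Fin n → Bool) (g : Fin n → ℕ) →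
  (∀ v → P v ≡ false) ⊎ (Σ (Fin n) λ w → P w ≡ true × (∀ v → P v ≡ true → g v ≤ g w))
argmax {zero}  P g = inj₁ λ ()
argmax {suc n} P g with argmax (P ∘ fsuc) (g ∘ fsuc) | P fzero in e
... | inj₁ none | false = inj₁ λ { fzero → e ; (fsuc v) → none v }
... | inj₁ none | true  = inj₂ (fzero , e , λ { fzero _ → ≤-refl ; (fsuc v) Pv → ⊥-elim (true≢false (trans (sym Pv) (none v))) })
... | inj₂ (w , Pw , max) | false = inj₂ (fsuc w , Pw , λ { fzero P0 → ⊥-elim (true≢false (trans (sym P0) e)) ; (fsuc v) Pv → max v Pv })
... | inj₂ (w , Pw , max) | true with g fzero ≤? g (fsuc w)
...   | yes le = inj₂ (fsuc w , Pw , λ { fzero _ → le ; (fsuc v) Pv → max v Pv })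
...   | no  gt = inj₂ (fzero , e , λ { fzero _ → ≤-refl ; (fsuc v) Pv → ≤-trans (max v Pv) (<⇒≤ (≰⇒> gt)) })

argmin : (P : Fin n → Bool) (g : Fin n → ℕ) → ∀ w₀ → P w₀ ≡ true →
  Σ (Fin n) λ w → P w ≡ true × (∀ v → P v ≡ true → g w ≤ g v)
argmin P g w₀ Pw₀ with argmax P (λ v → sumFin g ∸ g v)
... | inj₁ none = ⊥-elim (true≢false (trans (sym Pw₀) (none w₀)))
... | inj₂ (w , Pw , max) = w , Pw , λ v Pv → ∸-cancelʳ-≤ (term≤sumFin g w) (max v Pv)

module _ {P : ℕ → Set} (P? : Decidable P) where

  least-≤ : ∀ N → (Σ ℕ λ j → P j × (∀ i → P i → j ≤ i)) ⊎ (∀ i → i ≤ N → ¬ P i)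
  least-≤ zero with P? 0
  ... | yes p₀ = inj₁ (0 , p₀ , λ _ _ → z≤n)
  ... | no ¬p₀ = inj₂ λ { .0 z≤n → ¬p₀ }
  least-≤ (suc N) with least-≤ N
  ... | inj₁ found = inj₁ found
  ... | inj₂ none with P? (suc N)
  ...   | yes p = inj₁ (suc N , p , λ i pᵢ → ≮⇒≥ λ i<1+N → none i (≤-pred i<1+N) pᵢ)
  ...   | no ¬p = inj₂ none≤1+N
    where
    none≤1+N : ∀ i → i ≤ suc N → ¬ P i
    none≤1+N i i≤1+N with m≤n⇒m<n∨m≡n i≤1+N
    ... | inj₁ i<1+N = none i (≤-pred i<1+N)
    ... | inj₂ refl  = ¬p

  least : ∀ N → P N → Σ ℕ λ j → P j × (∀ i → P i → j ≤ i)
  least N p with least-≤ N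
  ... | inj₁ found = found
  ... | inj₂ none  = ⊥-elim (none N ≤-refl p)

  greatest-≤ : ∀ N → P 0 → Σ ℕ λ j → P j × j ≤ N × (∀ i → i ≤ N → P i → i ≤ j)
  greatest-≤ zero    p₀ = 0 , p₀ , z≤n , λ { .0 z≤n _ → z≤n }
  greatest-≤ (suc N) p₀ with P? (suc N)
  ... | yes p = suc N , p , ≤-refl , λ _ i≤1+N _ → i≤1+N
  ... | no ¬p with greatest-≤ N p₀
  ...   | j , pj , j≤N , max = j , pj , m≤n⇒m≤1+n j≤N , max≤1+N
    where
    max≤1+N : ∀ i → i ≤ suc N → P i → i ≤ j
    max≤1+N i i≤1+N pᵢ with m≤n⇒m<n∨m≡n i≤1+N
    ... | inj₁ i<1+N = max i (≤-pred i<1+N) pᵢ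
    ... | inj₂ refl  = ⊥-elim (¬p pᵢ)

injective-bounded⇒surjective : (g : Fin n → ℕ) → (∀ v → g v < n) → (∀ u v → g u ≡ g v → u ≡ v) →
  ∀ j → j < n → ∃ λ v → g v ≡ j
injective-bounded⇒surjective {suc m} g g<n g-inj j j<n with Finₚ.any? (λ v → g v ≟ℕ j)
... | yes hit = hit
... | no miss = ⊥-elim (<-irrefl refl (injective⇒≤ squeezed-injective))
  where
  j≢g : ∀ v → fromℕ< j<n ≢ fromℕ< (g<n v)
  j≢g v eq = miss (v , trans (sym (toℕ-fromℕ< (g<n v))) (trans (cong toℕ (sym eq)) (toℕ-fromℕ< j<n)))
  squeezed : Fin (suc m) → Fin m
  squeezed v = punchOut (j≢g v)
  squeezed-injective : ∀ {u v} → squeezed u ≡ squeezed v → u ≡ v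
  squeezed-injective {u} {v} eq = g-inj u v
    (trans (sym (toℕ-fromℕ< (g<n u))) (trans (cong toℕ (punchOut-injective (j≢g u) (j≢g v) eq)) (toℕ-fromℕ< (g<n v))))

lex-< : ∀ {M a c x} y → x < M → a < c → a * M + x < c * M + y
lex-< {M} {a} {c} {x} y x<M a<c = begin-strict
  a * M + x  <⟨ +-monoʳ-< (a * M) x<M ⟩
  a * M + M  ≡⟨ +-comm (a * M) M ⟩
  suc a * M  ≤⟨ *-monoˡ-≤ M a<c ⟩
  c * M      ≤⟨ m≤m+n (c * M) y ⟩
  c * M + y  ∎
  where open ≤-Reasoning

lex-<⁻ : ∀ {M x y} a c → x < M → y < M → a * M + x < c * M + y → a < c ⊎ (a ≡ c × x < y)
lex-<⁻ {M} {x} {y} a c x<M y<M lt with <-cmp a c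
... | tri< a<c _ _ = inj₁ a<c
... | tri≈ _ refl _ = inj₂ (refl , +-cancelˡ-< (a * M) x y lt)
... | tri> _ _ c<a = ⊥-elim (<-asym lt (lex-< x y<M c<a))

lex-injective : ∀ {M x y} a c → x < M → y < M → a * M + x ≡ c * M + y → a ≡ c × x ≡ y
lex-injective {M} {x} {y} a c x<M y<M eq with <-cmp a c
... | tri< a<c _ _ = ⊥-elim (<-irrefl eq (lex-< y x<M a<c))
... | tri≈ _ refl _ = refl , +-cancelˡ-≡ (a * M) x y eq
... | tri> _ _ c<a = ⊥-elim (<-irrefl (sym eq) (lex-< x y<M c<a))

ℕ→ℚ≡mkℚ : ∀ a → ℕ→ℚ a ≡ mkℚ (ℤ.+ a) 0 (coprime-sym (1-coprimeTo a))
ℕ→ℚ≡mkℚ a = normalize-coprime (coprime-sym (1-coprimeTo a))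

private
  +a*1≡+a : ∀ a → ℤ.+ a ℤ.* ℤ.+ 1 ≡ ℤ.+ a
  +a*1≡+a a = ℤ.*-identityʳ (ℤ.+ a)

ℕ→ℚ-mono-< : ∀ {a b} → a < b → ℕ→ℚ a ℚ.< ℕ→ℚ b
ℕ→ℚ-mono-< {a} {b} a<b rewrite ℕ→ℚ≡mkℚ a | ℕ→ℚ≡mkℚ b =
  *<* (subst₂ ℤ._<_ (sym (+a*1≡+a a)) (sym (+a*1≡+a b)) (ℤ.+<+ a<b))

ℕ→ℚ-cancel-< : ∀ a b → ℕ→ℚ a ℚ.< ℕ→ℚ b → a < b
ℕ→ℚ-cancel-< a b a<b rewrite ℕ→ℚ≡mkℚ a | ℕ→ℚ≡mkℚ b
  with subst₂ ℤ._<_ (+a*1≡+a a) (+a*1≡+a b) (drop-*<* a<b)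
... | ℤ.+<+ a<b′ = a<b′

ℕ→ℚ-mono-≤ : ∀ {a b} → a ≤ b → ℕ→ℚ a ℚ.≤ ℕ→ℚ b
ℕ→ℚ-mono-≤ {a} {b} a≤b rewrite ℕ→ℚ≡mkℚ a | ℕ→ℚ≡mkℚ b =
  *≤* (subst₂ ℤ._≤_ (sym (+a*1≡+a a)) (sym (+a*1≡+a b)) (ℤ.+≤+ a≤b))

module Boundary {n} (G : Graph n) where

  InBoundary : (Fin n → Bool) → Fin n → Set
  InBoundary T v = T v ≡ true × ∃ λ u → Edge G v u × T u ≡ false

  inBoundary? : ∀ T v → Dec (InBoundary T v)
  inBoundary? T v = (T v ≟ᵇ true) ×-dec Finₚ.any? (λ u → (adj G v u ≟ᵇ true) ×-dec (T u ≟ᵇ false))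

  ∂ : (Fin n → Bool) → Fin n → Bool
  ∂ T v = ⌊ inBoundary? T v ⌋

  ∣∂_∣ : (Fin n → Bool) → ℕ
  ∣∂ T ∣ = countFin (∂ T)

  ∂-intro : ∀ T v u → T v ≡ true → Edge G v u → T u ≡ false → ∂ T v ≡ true
  ∂-intro T v u Tv vu Tu = ⌊⌋-true (inBoundary? T v) (Tv , u , vu , Tu)

  ∂-elim : ∀ T v → ∂ T v ≡ true → InBoundary T v
  ∂-elim T v = ⌊⌋-true⁻¹ (inBoundary? T v)

  ∣∂∣-empty : ∀ T → (∀ v → T v ≡ false) → ∣∂ T ∣ ≡ 0
  ∣∂∣-empty T empty = sumFin-zero _ λ v → cong 𝟙 (⌊⌋-false (inBoundary? T v) λ (Tv , _) → true≢false (trans (sym Tv) (empty v)))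

  ∣∂∣-full : ∀ T → (∀ v → T v ≡ true) → ∣∂ T ∣ ≡ 0
  ∣∂∣-full T full = sumFin-zero _ λ v →
    cong 𝟙 (⌊⌋-false (inBoundary? T v) λ (_ , u , _ , Tu) → true≢false (trans (sym (full u)) Tu))

before : (Fin n → ℕ) → Fin n → Fin n → Bool
before κ w u = ⌊ κ u <? κ w ⌋

module Ranking {n} (κ : Fin n → ℕ) (κ-injective : ∀ u v → κ u ≡ κ v → u ≡ v) where

  before-irrefl : ∀ v → before κ v v ≡ false
  before-irrefl v = ⌊⌋-false (κ v <? κ v) (<-irrefl refl)

  opaque
    rank : Fin n → ℕ
    rank v = countFin (before κ v)

    rank<n : ∀ v → rank v < n
    rank<n v = subst (rank v <_) countFin-all
      (countFin-< (λ _ _ → refl) v refl (before-irrefl v))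

    rank-mono-< : ∀ u v → κ u < κ v → rank u < rank v
    rank-mono-< u v κu<κv = countFin-<
      (λ i i<u → ⌊⌋-true (κ i <? κ v) (<-trans (⌊⌋-true⁻¹ (κ i <? κ u) i<u) κu<κv))
      u (⌊⌋-true (κ u <? κ v) κu<κv) (before-irrefl u)

  rank-injective : ∀ u v → rank u ≡ rank v → u ≡ v
  rank-injective u v eq with <-cmp (κ u) (κ v)
  ... | tri< lt _ _ = ⊥-elim (<-irrefl eq (rank-mono-< u v lt))
  ... | tri≈ _ eq′ _ = κ-injective u v eq′
  ... | tri> _ _ gt = ⊥-elim (<-irrefl (sym eq) (rank-mono-< v u gt))

  rank-cancel-< : ∀ u v → rank u < rank v → κ u < κ v
  rank-cancel-< u v lt with <-cmp (κ u) (κ v)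
  ... | tri< κu<κv _ _ = κu<κv
  ... | tri≈ _ eq _ rewrite κ-injective u v eq = ⊥-elim (<-irrefl refl lt)
  ... | tri> _ _ gt = ⊥-elim (<-asym lt (rank-mono-< v u gt))

  rank-surjective : ∀ j → j < n → ∃ λ v → rank v ≡ j
  rank-surjective = injective-bounded⇒surjective rank rank<n rank-injective

-- The interval supergraph of a vertex ordering

closedNbr-self : ∀ {n} (G : Graph n) v → closedNbr G v v ≡ true
closedNbr-self G v = cong (_∨ adj G v v) (⌊⌋-true (v ≟ v) refl)

closedNbr-edge : ∀ {n} (G : Graph n) {v u} → Edge G v u → closedNbr G v u ≡ true
closedNbr-edge G {v} {u} vu rewrite vu = ∨-zeroʳ (⌊ u ≟ v ⌋)

closedNbr-other : ∀ {n} (G : Graph n) {v u} → closedNbr G v u ≡ true → u ≢ v → Edge G v u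
closedNbr-other G {v} {u} nbr u≢v rewrite ⌊⌋-false (u ≟ v) u≢v = nbr

module IntervalModel {n} (G : Graph n) (κ : Fin n → ℕ) (κ-injective : ∀ u v → κ u ≡ κ v → u ≡ v) where
  open Boundary G
  open Ranking κ κ-injective

  lastNbrSpec : ∀ v → Σ (Fin n) λ w → closedNbr G v w ≡ true × (∀ u → closedNbr G v u ≡ true → rank u ≤ rank w)
  lastNbrSpec v with argmax (closedNbr G v) rank
  ... | inj₁ none = ⊥-elim (true≢false (trans (sym (closedNbr-self G v)) (none v)))
  ... | inj₂ found = found

  opaque
    lastNbr : Fin n → Fin n
    lastNbr v = proj₁ (lastNbrSpec v)

    lastNbr-closedNbr : ∀ v → closedNbr G v (lastNbr v) ≡ true
    lastNbr-closedNbr v = proj₁ (proj₂ (lastNbrSpec v))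

    rank≤lastNbr : ∀ v u → closedNbr G v u ≡ true → rank u ≤ rank (lastNbr v)
    rank≤lastNbr v = proj₂ (proj₂ (lastNbrSpec v))

  reach : Fin n → ℕ
  reach v = rank (lastNbr v)

  -- The left endpoints 1, …, n follow the order; the right endpoint reach v + 2 makes the
  -- open interval of v meet that of u exactly when rank v ≤ rank u ≤ reach v (or vice versa).
  opaque
    I : IntervalRep n
    I = record
      { left     = λ v → suc (rank v)
      ; right    = λ v → suc (suc (reach v))
      ; nonempty = λ v → s≤s (s≤s (rank≤lastNbr v v (closedNbr-self G v)))
      }

    left<left⇒rank< : ∀ u v → left I u < left I v → rank u < rank v
    left<left⇒rank< u v = ≤-pred

    left<right⇒rank≤reach : ∀ u v → left I u < right I v → rank u ≤ reach v
    left<right⇒rank≤reach u v = ≤-pred ∘ ≤-pred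

    rank≤reach⇒left<right : ∀ u v → rank u ≤ reach v → left I u < right I v
    rank≤reach⇒left<right u v = s≤s ∘ s≤s

    left≡suc-rank : ∀ v → left I v ≡ suc (rank v)
    left≡suc-rank v = refl

  Overlap : Fin n → Fin n → Set
  Overlap u v = u ≢ v × left I u < right I v × left I v < right I u

  overlap? : ∀ u v → Dec (Overlap u v)
  overlap? u v = ¬? (u ≟ v) ×-dec (left I u <? right I v) ×-dec (left I v <? right I u)

  G′ : Graph n
  G′ = record
    { adj     = λ u v → ⌊ overlap? u v ⌋
    ; adj-sym = λ u v → ⌊⌋-⇔ (mk⇔ flip flip) (overlap? u v) (overlap? v u)
    ; adj-irr = λ v → ⌊⌋-false (overlap? v v) (λ (v≢v , _) → v≢v refl)
    }
    where
    flip : ∀ {u v} → Overlap u v → Overlap v u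
    flip (u≢v , uv , vu) = (λ eq → u≢v (sym eq)) , vu , uv

  common-point : ∀ u v → left I u < right I v → left I v < right I u →
    ∃ λ x → InInterval I u x × InInterval I v x
  common-point u v uv vu = x , (l<x (left I u) (m≤m⊔n (left I u) (left I v)) , x<r (right I u) (⊔-lub (nonempty I u) vu))
                             , (l<x (left I v) (m≤n⊔m (left I u) (left I v)) , x<r (right I v) (⊔-lub uv (nonempty I v)))
    where
    start : ℕ
    start = left I u ⊔ left I v
    between : ∃ λ x → ℕ→ℚ start ℚ.< x × x ℚ.< ℕ→ℚ (suc start)
    between = <-dense (ℕ→ℚ-mono-< (n<1+n start))
    x : ℚ
    x = proj₁ between
    l<x : ∀ a → a ≤ start → ℕ→ℚ a ℚ.< x
    l<x a a≤start = ℚ.≤-<-trans (ℕ→ℚ-mono-≤ a≤start) (proj₁ (proj₂ between))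
    x<r : ∀ b → suc start ≤ b → x ℚ.< ℕ→ℚ b
    x<r b 1+start≤b = ℚ.<-≤-trans (proj₂ (proj₂ between)) (ℕ→ℚ-mono-≤ 1+start≤b)

  represents : Represents I G′
  represents u v u≢v = mk⇔ to from
    where
    to : Edge G′ u v → ∃ λ x → InInterval I u x × InInterval I v x
    to e with ⌊⌋-true⁻¹ (overlap? u v) e
    ... | _ , uv , vu = common-point u v uv vu
    from : (∃ λ x → InInterval I u x × InInterval I v x) → Edge G′ u v
    from (x , (lu<x , x<ru) , (lv<x , x<rv)) = ⌊⌋-true (overlap? u v)
      (u≢v , ℕ→ℚ-cancel-< (left I u) (right I v) (ℚ.<-trans lu<x x<rv)
           , ℕ→ℚ-cancel-< (left I v) (right I u) (ℚ.<-trans lv<x x<ru))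

  canonical : Canonical I
  canonical = (λ v → subst (1 ≤_) (sym (left≡suc-rank v)) (s≤s z≤n)
                   , subst (_≤ n) (sym (left≡suc-rank v)) (rank<n v)) , every-left
    where
    every-left : ∀ k → 1 ≤ k → k ≤ n → Σ (Fin n) λ v → left I v ≡ k
    every-left (suc j) _ j<n with rank-surjective j j<n
    ... | v , rank≡j = v , trans (left≡suc-rank v) (cong suc rank≡j)

  supergraph : IsSupergraphVia G G′ (λ v → v)
  supergraph = (λ _ _ eq → eq) , λ u v uv →
    ⌊⌋-true (overlap? u v) (u≢v uv , rank≤reach⇒left<right u v (rank≤lastNbr v u (closedNbr-edge G (vu uv)))
                                     , rank≤reach⇒left<right v u (rank≤lastNbr u v (closedNbr-edge G uv)))
    where
    u≢v : ∀ {u v} → Edge G u v → u ≢ v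
    u≢v {u} uv refl = true≢false (trans (sym uv) (adj-irr G u))
    vu : ∀ {u v} → Edge G u v → Edge G v u
    vu {u} {v} uv = trans (adj-sym G v u) uv

  ∈∂before : ∀ v w → rank v < rank w → rank w ≤ reach v → ∂ (before κ w) v ≡ true
  ∈∂before v w v<w w≤reach = ∂-intro (before κ w) v last
    (⌊⌋-true (κ v <? κ w) (rank-cancel-< v w v<w))
    (closedNbr-other G (lastNbr-closedNbr v) last≢v)
    (⌊⌋-false (κ last <? κ w) λ lt → <-irrefl refl (<-≤-trans (rank-mono-< last w lt) w≤reach))
    where
    last = lastNbr v
    last≢v : last ≢ v
    last≢v eq = <-irrefl refl (<-≤-trans v<w (subst (λ u → rank w ≤ rank u) eq w≤reach))

  covers? : ∀ x v → Dec (InInterval I v x)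
  covers? x v = (ℕ→ℚ (left I v) <ℚ? x) ×-dec (x <ℚ? ℕ→ℚ (right I v))

  Covers : ℚ → Fin n → Bool
  Covers x v = ⌊ covers? x v ⌋

  covers-both : ∀ x v w → Covers x v ≡ true → Covers x w ≡ true → left I w < right I v
  covers-both x v w xv xw = ℕ→ℚ-cancel-< (left I w) (right I v)
    (ℚ.<-trans (proj₁ (⌊⌋-true⁻¹ (covers? x w) xw)) (proj₂ (⌊⌋-true⁻¹ (covers? x v) xv)))

  -- Every other interval through x starts before w and reaches beyond the left end of w.
  countFin-Covers-≤ : ∀ x w → Covers x w ≡ true → (∀ v → Covers x v ≡ true → rank v ≤ rank w) →
    countFin (Covers x) ≤ suc ∣∂ before κ w ∣
  countFin-Covers-≤ x w xw last = ≤-trans (countFin-∪ split)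
    (+-monoˡ-≤ ∣∂ before κ w ∣ (countFin-subsingleton (λ v → ⌊ v ≟ w ⌋)
      λ i j i≡w j≡w → trans (⌊⌋-true⁻¹ (i ≟ w) i≡w) (sym (⌊⌋-true⁻¹ (j ≟ w) j≡w))))
    where
    split : ∀ v → Covers x v ≡ true → ⌊ v ≟ w ⌋ ≡ true ⊎ ∂ (before κ w) v ≡ true
    split v xv = Sum.map (⌊⌋-true (v ≟ w)) (λ v≢w →
      ∈∂before v w (≤∧≢⇒< (last v xv) (v≢w ∘ rank-injective v w))
                   (left<right⇒rank≤reach w v (covers-both x v w xv xw)))
      (toSum (v ≟ w))

  mult-bounded : ∀ {c} t → (∀ w → t * suc ∣∂ before κ w ∣ ≤ c) → ∀ x → t * mult I x ≤ c
  mult-bounded {c} t bound x = [ nobody , lastCovering ]′ (argmax (Covers x) rank)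
    where
    lastCovering : (Σ (Fin n) λ w → Covers x w ≡ true × (∀ v → Covers x v ≡ true → rank v ≤ rank w)) →
      t * countFin (Covers x) ≤ c
    lastCovering (w , xw , last) = ≤-trans (*-monoʳ-≤ t (countFin-Covers-≤ x w xw last)) (bound w)
    nobody : (∀ v → Covers x v ≡ false) → t * countFin (Covers x) ≤ c
    nobody none = begin
      t * countFin (Covers x) ≡⟨ cong (t *_) (sumFin-zero (𝟙 ∘ Covers x) (cong 𝟙 ∘ none)) ⟩
      t * 0                   ≡⟨ *-zeroʳ t ⟩
      0                       ≤⟨ z≤n ⟩
      c                       ∎
      where open ≤-Reasoning

  icost-bounded : icost I ≤ sumFin (λ w → ∣∂ before κ w ∣)
  icost-bounded = sumFin-mono λ w → countFin-mono λ v xv →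
    let (lv<lw , lw<rv) = ⌊⌋-true⁻¹ (covers? (ℕ→ℚ (left I w)) v) xv
    in ∈∂before v w (left<left⇒rank< v w (ℕ→ℚ-cancel-< (left I v) (left I w) lv<lw))
                    (left<right⇒rank≤reach w v (ℕ→ℚ-cancel-< (left I w) (right I v) lw<rv))

-- Ordering the vertices by their first bag

∣p∣≡countFin : (p : Subset n) → ∣ p ∣ ≡ countFin (lookup p)
∣p∣≡countFin []          = refl
∣p∣≡countFin (true ∷ p)  = cong suc (∣p∣≡countFin p)
∣p∣≡countFin (false ∷ p) = ∣p∣≡countFin p

module FirstBagOrder {n} {G : Graph n} (D : PathDecomposition G) where
  open Boundary G

  firstBagSpec : ∀ v → Σ (Fin (len D)) λ i →
    lookup (bag D i) v ≡ true × (∀ j → lookup (bag D j) v ≡ true → toℕ i ≤ toℕ j)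
  firstBagSpec v = argmin (λ i → lookup (bag D i) v) toℕ (proj₁ (covers D v)) ([]=⇒lookup (proj₂ (covers D v)))

  firstBag : Fin n → Fin (len D)
  firstBag v = proj₁ (firstBagSpec v)

  ∈firstBag : ∀ v → v ∈ bag D (firstBag v)
  ∈firstBag v = lookup⇒[]= v (bag D (firstBag v)) (proj₁ (proj₂ (firstBagSpec v)))

  firstBag-minimal : ∀ v i → v ∈ bag D i → toℕ (firstBag v) ≤ toℕ i
  firstBag-minimal v i v∈i = proj₂ (proj₂ (firstBagSpec v)) i ([]=⇒lookup v∈i)

  π : Fin n → ℕ
  π v = toℕ (firstBag v) * n + toℕ v

  π< : ∀ v → π v < len D * n
  π< v = subst (π v <_) (+-identityʳ (len D * n)) (lex-< 0 (toℕ<n v) (toℕ<n (firstBag v)))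

  π-injective : ∀ u v → π u ≡ π v → u ≡ v
  π-injective u v eq = toℕ-injective (proj₂ (lex-injective (toℕ (firstBag u)) (toℕ (firstBag v)) (toℕ<n u) (toℕ<n v) eq))

  before⇒firstBag-≤ : ∀ w v → before π w v ≡ true → toℕ (firstBag v) ≤ toℕ (firstBag w)
  before⇒firstBag-≤ w v v<w with lex-<⁻ (toℕ (firstBag v)) (toℕ (firstBag w)) (toℕ<n v) (toℕ<n w) (⌊⌋-true⁻¹ (π v <? π w) v<w)
  ... | inj₁ lt       = <⇒≤ lt
  ... | inj₂ (eq , _) = ≤-reflexive eq

  ¬before⇒firstBag-≥ : ∀ w u → before π w u ≡ false → toℕ (firstBag w) ≤ toℕ (firstBag u)
  ¬before⇒firstBag-≥ w u u≮w = ≮⇒≥ λ lt →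
    true≢false (trans (sym (⌊⌋-true (π u <? π w) (lex-< (toℕ w) (toℕ<n u) lt))) u≮w)

  -- w and the boundary of the vertices preceding it all lie in the first bag of w.
  suc-∣∂before∣≤width : ∀ {k} → WidthPlusOneAtMost D k → ∀ w → suc ∣∂ before π w ∣ ≤ k
  suc-∣∂before∣≤width {k} width w = begin
    suc ∣∂ before π w ∣                         ≤⟨ countFin-< ∂⊆bag w ([]=⇒lookup (∈firstBag w)) w∉∂ ⟩
    countFin (lookup (bag D (firstBag w)))      ≡⟨ sym (∣p∣≡countFin (bag D (firstBag w))) ⟩
    ∣ bag D (firstBag w) ∣                      ≤⟨ width (firstBag w) ⟩
    k                                           ∎
    where
    open ≤-Reasoning
    w∉∂ : ∂ (before π w) w ≡ false
    w∉∂ rewrite Ranking.before-irrefl π π-injective w = refl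
    ∂⊆bag : ∀ v → ∂ (before π w) v ≡ true → lookup (bag D (firstBag w)) v ≡ true
    ∂⊆bag v v∈∂ with ∂-elim (before π w) v v∈∂
    ... | v<w , u , vu , u≮w with edgesIn D v u vu
    ...   | c , v∈c , u∈c = []=⇒lookup (interpol D (firstBag v) (firstBag w) c
              (before⇒firstBag-≤ w v v<w)
              (≤-trans (¬before⇒firstBag-≥ w u u≮w) (firstBag-minimal u c u∈c))
              (x∈p∩q⁺ (∈firstBag v , v∈c)))

-- Boundaries of the suffixes of a layout

suffix : (Fin n → ℕ) → ℕ → Fin n → Bool
suffix pos j v = ⌊ j ≤? pos v ⌋

minSel-≤-init : (P : Fin m → Bool) (g : Fin m → ℕ) (a : ℕ) → minSel P g a ≤ a
minSel-≤-init {zero}  P g a = ≤-refl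
minSel-≤-init {suc m} P g a with P fzero
... | true  = ≤-trans (minSel-≤-init (P ∘ fsuc) (g ∘ fsuc) _) (m⊓n≤m a (g fzero))
... | false = minSel-≤-init (P ∘ fsuc) (g ∘ fsuc) a

minSel-≤-selected : (P : Fin m → Bool) (g : Fin m → ℕ) (a : ℕ) (i : Fin m) → P i ≡ true → minSel P g a ≤ g i
minSel-≤-selected {suc m} P g a fzero Pi rewrite Pi =
  ≤-trans (minSel-≤-init (P ∘ fsuc) (g ∘ fsuc) _) (m⊓n≤n a (g fzero))
minSel-≤-selected {suc m} P g a (fsuc i) Pi with P fzero
... | true  = minSel-≤-selected (P ∘ fsuc) (g ∘ fsuc) _ i Pi
... | false = minSel-≤-selected (P ∘ fsuc) (g ∘ fsuc) a i Pi

module _ {n} (pos : Fin n → ℕ) (pos-injective : ∀ u v → pos u ≡ pos v → u ≡ v) where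

  InWindow : ℕ → ℕ → Fin n → Set
  InWindow lo d w = lo ≤ pos w × pos w < lo + d

  inWindow? : ∀ lo d w → Dec (InWindow lo d w)
  inWindow? lo d w = (lo ≤? pos w) ×-dec (pos w <? lo + d)

  countFin-window : ∀ lo d → countFin (λ w → ⌊ inWindow? lo d w ⌋) ≤ d
  countFin-window lo zero = ≤-reflexive (sumFin-zero _ λ w →
    cong 𝟙 (⌊⌋-false (inWindow? lo 0 w) λ (lo≤ , <lo+0) → <-irrefl refl (≤-<-trans lo≤ (subst (pos w <_) (+-identityʳ lo) <lo+0))))
  countFin-window lo (suc d) = ≤-trans (countFin-∪ split)
    (≤-trans (+-mono-≤ (countFin-window lo d) (countFin-subsingleton _ unique)) (≤-reflexive (+-comm d 1)))
    where
    split : ∀ w → ⌊ inWindow? lo (suc d) w ⌋ ≡ true → ⌊ inWindow? lo d w ⌋ ≡ true ⊎ ⌊ pos w ≟ℕ lo + d ⌋ ≡ true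
    split w inside =
      let (lo≤ , <lo+1+d) = ⌊⌋-true⁻¹ (inWindow? lo (suc d) w) inside
      in Sum.map (λ <lo+d → ⌊⌋-true (inWindow? lo d w) (lo≤ , <lo+d))
                 (λ ≮lo+d → ⌊⌋-true (pos w ≟ℕ lo + d)
                   (≤-antisym (≤-pred (subst (pos w <_) (+-suc lo d) <lo+1+d)) (≮⇒≥ ≮lo+d)))
                 (toSum (pos w <? lo + d))
    unique : ∀ u v → ⌊ pos u ≟ℕ lo + d ⌋ ≡ true → ⌊ pos v ≟ℕ lo + d ⌋ ≡ true → u ≡ v
    unique u v eu ev = pos-injective u v (trans (⌊⌋-true⁻¹ (pos u ≟ℕ _) eu) (sym (⌊⌋-true⁻¹ (pos v ≟ℕ _) ev)))

-- v is on the boundary of the suffix starting at j only if mn v < j ≤ pos v, where mn v is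
-- the first position in the closed neighbourhood of v; each such j is the position of
-- exactly one vertex.
Σ∣∂suffix∣≤profile : ∀ {n} (G : Graph n) (f : Fin n → Fin n) → Injective _≡_ _≡_ f →
  sumFin (λ w → Boundary.∣∂_∣ G (suffix (toℕ ∘ f) (toℕ (f w)))) ≤ profOf G f
Σ∣∂suffix∣≤profile {n} G f f-injective = begin
  sumFin (λ w → sumFin (λ v → 𝟙 (∂ (S w) v)))  ≡⟨ sumFin-comm (λ w v → 𝟙 (∂ (S w) v)) ⟩
  sumFin (λ v → countFin (λ w → ∂ (S w) v))     ≤⟨ sumFin-mono per-vertex ⟩
  profOf G f                                    ∎
  where
  open ≤-Reasoning
  open Boundary G
  pos : Fin n → ℕ
  pos = toℕ ∘ f
  S : Fin n → Fin n → Bool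
  S w = suffix pos (pos w)
  mn : Fin n → ℕ
  mn v = minSel (closedNbr G v) pos (pos v)
  per-vertex : ∀ v → countFin (λ w → ∂ (S w) v) ≤ pos v ∸ mn v
  per-vertex v = ≤-trans (countFin-mono in-window) (countFin-window pos pos-injective (suc (mn v)) (pos v ∸ mn v))
    where
    pos-injective : ∀ u w → pos u ≡ pos w → u ≡ w
    pos-injective u w eq = f-injective (toℕ-injective eq)
    in-window : ∀ w → ∂ (S w) v ≡ true → ⌊ inWindow? pos pos-injective (suc (mn v)) (pos v ∸ mn v) w ⌋ ≡ true
    in-window w v∈∂ with ∂-elim (S w) v v∈∂
    ... | w≤v , u , vu , u∉S = ⌊⌋-true (inWindow? pos pos-injective _ _ w)
          ( ≤-<-trans (minSel-≤-selected (closedNbr G v) pos (pos v) u (closedNbr-edge G vu))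
                      (≰⇒> (λ w≤u → true≢false (trans (sym (⌊⌋-true (pos w ≤? pos u) w≤u)) u∉S)))
          , subst (pos w <_) (sym (cong suc (m+[n∸m]≡n (minSel-≤-init (closedNbr G v) pos (pos v)))))
                  (s≤s (⌊⌋-true⁻¹ (pos w ≤? pos v) w≤v)) )

-- Cutting a layout at checkpoints

module CheckpointOrder {n} (G : Graph n)
  (π : Fin n → ℕ) (π-injective : ∀ u v → π u ≡ π v → u ≡ v) (M : ℕ) (π<M : ∀ v → π v < M)
  (k : ℕ) (π-bound : ∀ w → suc (Boundary.∣∂_∣ G (before π w)) ≤ k)
  (pos : Fin n → ℕ) (pos<n : ∀ v → pos v < n) (pos-injective : ∀ u v → pos u ≡ pos v → u ≡ v)
  (t : ℕ) where
  open Boundary G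

  S : ℕ → Fin n → Bool
  S = suffix pos

  Checkpoint : ℕ → Set
  Checkpoint j = t * ∣∂ S j ∣ ≤ k

  checkpoint? : Decidable Checkpoint
  checkpoint? j = t * ∣∂ S j ∣ ≤? k

  S-beyond : ∀ {j} → n ≤ j → ∀ v → S j v ≡ false
  S-beyond n≤j v = ⌊⌋-false (_ ≤? pos v) λ j≤v → <-irrefl refl (<-≤-trans (pos<n v) (≤-trans n≤j j≤v))

  checkpoint-beyond : ∀ {j} → n ≤ j → Checkpoint j
  checkpoint-beyond {j} n≤j rewrite ∣∂∣-empty (S j) (S-beyond n≤j) | *-zeroʳ t = z≤n

  checkpoint-0 : Checkpoint 0
  checkpoint-0 rewrite ∣∂∣-full (S 0) (λ v → ⌊⌋-true (0 ≤? pos v) z≤n) | *-zeroʳ t = z≤n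

  prevSpec : ∀ w → Σ ℕ λ a → Checkpoint a × a ≤ pos w × (∀ i → i ≤ pos w → Checkpoint i → i ≤ a)
  prevSpec w = greatest-≤ checkpoint? (pos w) checkpoint-0

  opaque
    prev : Fin n → ℕ
    prev w = proj₁ (prevSpec w)

    prev-checkpoint : ∀ w → Checkpoint (prev w)
    prev-checkpoint w = proj₁ (proj₂ (prevSpec w))

    prev≤pos : ∀ w → prev w ≤ pos w
    prev≤pos w = proj₁ (proj₂ (proj₂ (prevSpec w)))

    prev-maximal : ∀ w i → i ≤ pos w → Checkpoint i → i ≤ prev w
    prev-maximal w = proj₂ (proj₂ (proj₂ (prevSpec w)))

  prev<n : ∀ w → prev w < n
  prev<n w = ≤-<-trans (prev≤pos w) (pos<n w)

  nextCheckpoint : ∀ j → j < n →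
    Σ ℕ λ a → Checkpoint a × j < a × (∀ i → Checkpoint i → j < i → a ≤ i)
  nextCheckpoint j j<n with least (λ i → checkpoint? i ×-dec (j <? i)) n (checkpoint-beyond ≤-refl , j<n)
  ... | a , (cp-a , j<a) , min = a , cp-a , j<a , λ i cp-i j<i → min i (cp-i , j<i)

  -- Blocks between consecutive checkpoints are listed from the last to the first,
  -- each one internally in the order π.
  τ : Fin n → ℕ
  τ u = (n ∸ prev u) * M + π u

  τ-injective : ∀ u v → τ u ≡ τ v → u ≡ v
  τ-injective u v eq = π-injective u v (proj₂ (lex-injective (n ∸ prev u) (n ∸ prev v) (π<M u) (π<M v) eq))

  cost : Fin n → ℕ
  cost w = ∣∂ before τ w ∣

  budget-at : ℕ → ℕ
  budget-at j = (t + 2) * ∣∂ S j ∣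

  budget : Fin n → ℕ
  budget w = budget-at (pos w)

  Invariant : ℕ → Set
  Invariant a = sumOn (S a) cost + ∣∂ S a ∣ ≤ sumOn (S a) budget

  module Block (a′ a : ℕ) (cp-a′ : Checkpoint a′) (cp-a : Checkpoint a) (a′<a : a′ < a)
               (gap : ∀ i → Checkpoint i → a′ < i → a ≤ i) where

    InBlock : Fin n → Set
    InBlock u = a′ ≤ pos u × pos u < a

    inBlock? : ∀ u → Dec (InBlock u)
    inBlock? u = (a′ ≤? pos u) ×-dec (pos u <? a)

    B : Fin n → Bool
    B u = ⌊ inBlock? u ⌋

    prev-inBlock : ∀ u → InBlock u → prev u ≡ a′
    prev-inBlock u (a′≤u , u<a) = ≤-antisym
      (≮⇒≥ λ a′<p → <-irrefl refl (<-≤-trans u<a (≤-trans (gap (prev u) (prev-checkpoint u) a′<p) (prev≤pos u))))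
      (prev-maximal u a′ a′≤u cp-a′)

    later⇒prev> : ∀ u → a ≤ pos u → a′ < prev u
    later⇒prev> u a≤u = <-≤-trans a′<a (prev-maximal u a a≤u cp-a)

    prev>⇒later : ∀ u → a′ < prev u → a ≤ pos u
    prev>⇒later u a′<p = ≤-trans (gap (prev u) (prev-checkpoint u) a′<p) (prev≤pos u)

    prev≡⇒InBlock : ∀ u → prev u ≡ a′ → InBlock u
    prev≡⇒InBlock u p≡a′ = subst (_≤ pos u) p≡a′ (prev≤pos u)
                         , ≰⇒> λ a≤u → <-irrefl (sym p≡a′) (later⇒prev> u a≤u)

    module _ (w : Fin n) (w∈B : InBlock w) where

      prev-w : prev w ≡ a′
      prev-w = prev-inBlock w w∈B

      before-τ⁻ : ∀ u → before τ w u ≡ true → a ≤ pos u ⊎ (InBlock u × π u < π w)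
      before-τ⁻ u u<w with lex-<⁻ (n ∸ prev u) (n ∸ prev w) (π<M u) (π<M w) (⌊⌋-true⁻¹ (τ u <? τ w) u<w)
      ... | inj₁ lt = inj₁ (prev>⇒later u (subst (_< prev u) prev-w
                      (≰⇒> λ p≤ → <-irrefl refl (<-≤-trans lt (∸-monoʳ-≤ n p≤)))))
      ... | inj₂ (eq , π<) = inj₂ (prev≡⇒InBlock u (trans (∸-cancelˡ-≡ (<⇒≤ (prev<n u)) (<⇒≤ (prev<n w)) eq) prev-w) , π<)

      later⇒before-τ : ∀ u → a ≤ pos u → before τ w u ≡ true
      later⇒before-τ u a≤u = ⌊⌋-true (τ u <? τ w) (lex-< (π w) (π<M u)
        (∸-monoʳ-< (subst (_< prev u) (sym prev-w) (later⇒prev> u a≤u)) (<⇒≤ (prev<n u))))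

      block⇒before-τ : ∀ u → InBlock u → π u < π w → before τ w u ≡ true
      block⇒before-τ u u∈B π< = ⌊⌋-true (τ u <? τ w)
        (subst (λ p → (n ∸ p) * M + π u < τ w) (sym (trans (prev-inBlock u u∈B) (sym prev-w))) (+-monoʳ-< _ π<))

      ∂S-a : ∀ v u → a ≤ pos v → Edge G v u → before τ w u ≡ false → ∂ (S a) v ≡ true
      ∂S-a v u a≤v vu u≮w = ∂-intro (S a) v u (⌊⌋-true (a ≤? pos v) a≤v) vu
        (⌊⌋-false (a ≤? pos u) λ a≤u → true≢false (trans (sym (later⇒before-τ u a≤u)) u≮w))

      ∂before-τ⊆ : ∀ v → ∂ (before τ w) v ≡ true →
        ∂ (S a) v ≡ true ⊎ ∂ (S a′) v ≡ true ⊎ ∂ (before π w) v ≡ true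
      ∂before-τ⊆ v v∈∂ with ∂-elim (before τ w) v v∈∂
      ... | v<w , u , vu , u≮w with before-τ⁻ v v<w
      ... | inj₁ a≤v = inj₁ (∂S-a v u a≤v vu u≮w)
      ... | inj₂ (v∈B , πv<πw) with π u <? π w
      ...   | no πu≮πw = inj₂ (inj₂ (∂-intro (before π w) v u (⌊⌋-true (π v <? π w) πv<πw) vu (⌊⌋-false (π u <? π w) πu≮πw)))
      ...   | yes πu<πw = inj₂ (inj₁ (∂-intro (S a′) v u (⌊⌋-true (a′ ≤? pos v) (proj₁ v∈B)) vu (⌊⌋-false (a′ ≤? pos u) u∉S)))
        where
        u∉S : ¬ a′ ≤ pos u
        u∉S a′≤u with pos u <? a
        ... | yes u<a = true≢false (trans (sym (block⇒before-τ u (a′≤u , u<a) πu<πw)) u≮w)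
        ... | no  u≮a = true≢false (trans (sym (later⇒before-τ u (≮⇒≥ u≮a))) u≮w)

      cost≤ : cost w ≤ ∣∂ S a ∣ + (∣∂ S a′ ∣ + ∣∂ before π w ∣)
      cost≤ = countFin-∪₃ ∂before-τ⊆

      cost-first : (∀ v → InBlock v → π w ≤ π v) → cost w ≤ ∣∂ S a ∣
      cost-first first = countFin-mono ∂⊆∂S-a
        where
        ∂⊆∂S-a : ∀ v → ∂ (before τ w) v ≡ true → ∂ (S a) v ≡ true
        ∂⊆∂S-a v v∈∂ with ∂-elim (before τ w) v v∈∂
        ... | v<w , u , vu , u≮w with before-τ⁻ v v<w
        ... | inj₁ a≤v = ∂S-a v u a≤v vu u≮w
        ... | inj₂ (v∈B , πv<πw) = ⊥-elim (<-irrefl refl (<-≤-trans πv<πw (first v v∈B)))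

    extra : ℕ
    extra = ∣∂ S a′ ∣ + k

    interior-budget : ∀ j → a′ < j → j < a → ∣∂ S a ∣ + extra ≤ budget-at j
    interior-budget j a′<j j<a = begin
      ∣∂ S a ∣ + (∣∂ S a′ ∣ + k)                ≤⟨ +-mono-≤ (below cp-a) (+-mono-≤ (below cp-a′) (<⇒≤ k<t*∂j)) ⟩
      ∣∂ S j ∣ + (∣∂ S j ∣ + t * ∣∂ S j ∣)      ≡⟨ x+[x+t*x]≡[t+2]*x t ∣∂ S j ∣ ⟩
      budget-at j                               ∎
      where
      open ≤-Reasoning
      k<t*∂j : k < t * ∣∂ S j ∣
      k<t*∂j = ≰⇒> λ cp-j → <-irrefl refl (<-≤-trans j<a (gap j cp-j a′<j))
      below : ∀ {c} → Checkpoint c → ∣∂ S c ∣ ≤ ∣∂ S j ∣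
      below {c} cp-c = <⇒≤ (*-cancelˡ-< t ∣∂ S c ∣ ∣∂ S j ∣ (≤-<-trans cp-c k<t*∂j))

    suffix-split : ∀ w → 𝟙 (S a′ w) ≡ 𝟙 (B w) + 𝟙 (S a w)
    suffix-split w with a′ ≤? pos w | pos w <? a | a ≤? pos w
    ... | no  a′≰w | _       | no _    = refl
    ... | no  a′≰w | _       | yes a≤w = ⊥-elim (a′≰w (≤-trans (<⇒≤ a′<a) a≤w))
    ... | yes _    | yes _   | no _    = refl
    ... | yes _    | yes w<a | yes a≤w = ⊥-elim (<-irrefl refl (<-≤-trans w<a a≤w))
    ... | yes _    | no _    | yes _   = refl
    ... | yes _    | no w≮a  | no a≰w  = ⊥-elim (a≰w (≮⇒≥ w≮a))

    module Accounting (a′<n : a′ < n) where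

      vertexAt-a′ : ∃ λ w → pos w ≡ a′
      vertexAt-a′ = injective-bounded⇒surjective pos pos<n pos-injective a′ a′<n

      w* : Fin n
      w* = proj₁ vertexAt-a′

      pos-w* : pos w* ≡ a′
      pos-w* = proj₂ vertexAt-a′

      w*∈B : B w* ≡ true
      w*∈B = ⌊⌋-true (inBlock? w*) (≤-reflexive (sym pos-w*) , subst (_< a) (sym pos-w*) a′<a)

      π-first : Σ (Fin n) λ w → B w ≡ true × (∀ v → B v ≡ true → π w ≤ π v)
      π-first = argmin B π w* w*∈B

      w₀ : Fin n
      w₀ = proj₁ π-first

      Others : Fin n → Bool
      Others w = ⌊ inBlock? w ×-dec ¬? (w ≟ w₀) ⌋

      Interior : Fin n → Bool
      Interior w = ⌊ (a′ <? pos w) ×-dec (pos w <? a) ⌋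

      cost-in-block : ∀ w → 𝟙 (B w) * cost w ≤ 𝟙 (B w) * ∣∂ S a ∣ + 𝟙 (Others w) * extra
      cost-in-block w with inBlock? w
      ... | no _ = z≤n
      ... | yes w∈B with w ≟ w₀
      ...   | yes refl = begin
              1 * cost w₀                  ≡⟨ *-identityˡ (cost w₀) ⟩
              cost w₀                      ≤⟨ cost-first w₀ w∈B (λ v v∈B → proj₂ (proj₂ π-first) v (⌊⌋-true (inBlock? v) v∈B)) ⟩
              ∣∂ S a ∣                     ≡⟨ sym (*-identityˡ ∣∂ S a ∣) ⟩
              1 * ∣∂ S a ∣                 ≤⟨ m≤m+n (1 * ∣∂ S a ∣) (0 * extra) ⟩
              1 * ∣∂ S a ∣ + 0 * extra     ∎
        where open ≤-Reasoning
      ...   | no _ = begin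
              1 * cost w                   ≡⟨ *-identityˡ (cost w) ⟩
              cost w                       ≤⟨ cost≤ w w∈B ⟩
              ∣∂ S a ∣ + (∣∂ S a′ ∣ + ∣∂ before π w ∣)
                                           ≤⟨ +-monoʳ-≤ ∣∂ S a ∣ (+-monoʳ-≤ ∣∂ S a′ ∣ (<⇒≤ (π-bound w))) ⟩
              ∣∂ S a ∣ + extra             ≡⟨ sym (cong₂ _+_ (*-identityˡ ∣∂ S a ∣) (*-identityˡ extra)) ⟩
              1 * ∣∂ S a ∣ + 1 * extra     ∎
        where open ≤-Reasoning

      ∣B∣≤1+∣Interior∣ : countFin B ≤ suc (countFin Interior)
      ∣B∣≤1+∣Interior∣ = begin
        countFin B                                          ≤⟨ countFin-∪ cover ⟩
        countFin Interior + countFin (λ w → ⌊ w ≟ w* ⌋)     ≤⟨ +-monoʳ-≤ (countFin Interior) (countFin-subsingleton _ unique) ⟩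
        countFin Interior + 1                               ≡⟨ +-comm (countFin Interior) 1 ⟩
        suc (countFin Interior)                             ∎
        where
        open ≤-Reasoning
        cover : ∀ w → B w ≡ true → Interior w ≡ true ⊎ ⌊ w ≟ w* ⌋ ≡ true
        cover w w∈B = let (a′≤w , w<a) = ⌊⌋-true⁻¹ (inBlock? w) w∈B in
          Sum.map (λ a′<w → ⌊⌋-true ((a′ <? pos w) ×-dec (pos w <? a)) (a′<w , w<a))
                  (λ a′≮w → ⌊⌋-true (w ≟ w*) (pos-injective w w* (trans (≤-antisym (≮⇒≥ a′≮w) a′≤w) (sym pos-w*))))
                  (toSum (a′ <? pos w))
        unique : ∀ i j → ⌊ i ≟ w* ⌋ ≡ true → ⌊ j ≟ w* ⌋ ≡ true → i ≡ j
        unique i j i≡w* j≡w* = trans (⌊⌋-true⁻¹ (i ≟ w*) i≡w*) (sym (⌊⌋-true⁻¹ (j ≟ w*) j≡w*))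

      ∣Others∣≤∣Interior∣ : countFin Others ≤ countFin Interior
      ∣Others∣≤∣Interior∣ = ≤-pred (≤-trans (countFin-< Others⊆B w₀ (proj₁ (proj₂ π-first)) w₀∉Others) ∣B∣≤1+∣Interior∣)
        where
        Others⊆B : ∀ w → Others w ≡ true → B w ≡ true
        Others⊆B w o = ⌊⌋-true (inBlock? w) (proj₁ (⌊⌋-true⁻¹ (inBlock? w ×-dec ¬? (w ≟ w₀)) o))
        w₀∉Others : Others w₀ ≡ false
        w₀∉Others = ⌊⌋-false (inBlock? w₀ ×-dec ¬? (w₀ ≟ w₀)) λ (_ , w₀≢w₀) → w₀≢w₀ refl

      block-cost : sumOn B cost ≤ ∣∂ S a ∣ + sumOn Interior budget
      block-cost = begin
        sumOn B cost                                          ≤⟨ sumFin-mono cost-in-block ⟩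
        sumFin (λ w → 𝟙 (B w) * X + 𝟙 (Others w) * extra)     ≡⟨ sumFin-+ (λ w → 𝟙 (B w) * X) (λ w → 𝟙 (Others w) * extra) ⟩
        sumOn B (λ _ → X) + sumOn Others (λ _ → extra)        ≡⟨ cong₂ _+_ (sumOn-const B X) (sumOn-const Others extra) ⟩
        countFin B * X + countFin Others * extra              ≤⟨ +-mono-≤ (*-monoˡ-≤ X ∣B∣≤1+∣Interior∣) (*-monoˡ-≤ extra ∣Others∣≤∣Interior∣) ⟩
        suc c * X + c * extra                                 ≡⟨ regroup c X extra ⟩
        X + c * (X + extra)                                   ≡⟨ cong (X +_) (sym (sumOn-const Interior (X + extra))) ⟩
        X + sumOn Interior (λ _ → X + extra)                  ≤⟨ +-monoʳ-≤ X (sumOn-mono Interior interior) ⟩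
        X + sumOn Interior budget                             ∎
        where
        open ≤-Reasoning
        X c : ℕ
        X = ∣∂ S a ∣
        c = countFin Interior
        regroup : ∀ c x y → suc c * x + c * y ≡ x + c * (x + y)
        regroup = solve-∀
        interior : ∀ w → Interior w ≡ true → X + extra ≤ budget w
        interior w w∈I = let (a′<w , w<a) = ⌊⌋-true⁻¹ ((a′ <? pos w) ×-dec (pos w <? a)) w∈I
                         in interior-budget (pos w) a′<w w<a

      block-budget : sumOn Interior budget + budget w* ≤ sumOn B budget
      block-budget = begin
        sumOn Interior budget + budget w*                         ≤⟨ +-monoʳ-≤ (sumOn Interior budget) budget-w*≤ ⟩
        sumOn Interior budget + sumOn (λ w → ⌊ w ≟ w* ⌋) budget   ≤⟨ sumOn-disjoint B Interior (λ w → ⌊ w ≟ w* ⌋) budget disjoint ⟩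
        sumOn B budget                                            ∎
        where
        open ≤-Reasoning
        budget-w*≤ : budget w* ≤ sumOn (λ w → ⌊ w ≟ w* ⌋) budget
        budget-w*≤ = subst (_≤ sumOn (λ w → ⌊ w ≟ w* ⌋) budget)
          (trans (cong (λ b → 𝟙 b * budget w*) (⌊⌋-true (w* ≟ w*) refl)) (+-identityʳ (budget w*)))
          (term≤sumFin (λ w → 𝟙 ⌊ w ≟ w* ⌋ * budget w) w*)
        disjoint : ∀ w → 𝟙 (Interior w) + 𝟙 ⌊ w ≟ w* ⌋ ≤ 𝟙 (B w)
        disjoint w with w ≟ w*
        ... | yes refl rewrite w*∈B | ⌊⌋-false ((a′ <? pos w*) ×-dec (pos w* <? a)) (λ (a′<w* , _) → <-irrefl (sym pos-w*) a′<w*) = ≤-refl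
        ... | no _ = ≤-trans (≤-reflexive (+-identityʳ _)) (𝟙-mono λ w∈I →
                       let (a′<w , w<a) = ⌊⌋-true⁻¹ ((a′ <? pos w) ×-dec (pos w <? a)) w∈I
                       in ⌊⌋-true (inBlock? w) (<⇒≤ a′<w , w<a))

      invariant-step : Invariant a → Invariant a′
      invariant-step ih = begin
        sumOn (S a′) cost + ∣∂ S a′ ∣
          ≡⟨ cong (_+ ∣∂ S a′ ∣) (sumOn-partition (S a′) B (S a) cost suffix-split) ⟩
        sumOn B cost + sumOn (S a) cost + ∣∂ S a′ ∣
          ≤⟨ +-monoˡ-≤ ∣∂ S a′ ∣ (+-monoˡ-≤ (sumOn (S a) cost) block-cost) ⟩
        ∣∂ S a ∣ + sumOn Interior budget + sumOn (S a) cost + ∣∂ S a′ ∣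
          ≡⟨ regroup ∣∂ S a ∣ (sumOn Interior budget) (sumOn (S a) cost) ∣∂ S a′ ∣ ⟩
        (sumOn (S a) cost + ∣∂ S a ∣) + (sumOn Interior budget + ∣∂ S a′ ∣)
          ≤⟨ +-mono-≤ ih (+-monoʳ-≤ (sumOn Interior budget) ∂a′≤budget-w*) ⟩
        sumOn (S a) budget + (sumOn Interior budget + budget w*)
          ≤⟨ +-monoʳ-≤ (sumOn (S a) budget) block-budget ⟩
        sumOn (S a) budget + sumOn B budget
          ≡⟨ +-comm (sumOn (S a) budget) (sumOn B budget) ⟩
        sumOn B budget + sumOn (S a) budget
          ≡⟨ sym (sumOn-partition (S a′) B (S a) budget suffix-split) ⟩
        sumOn (S a′) budget
          ∎
        where
        open ≤-Reasoning
        regroup : ∀ x i s y → x + i + s + y ≡ (s + x) + (i + y)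
        regroup = solve-∀
        ∂a′≤budget-w* : ∣∂ S a′ ∣ ≤ budget w*
        ∂a′≤budget-w* = subst (λ j → ∣∂ S a′ ∣ ≤ budget-at j) (sym pos-w*) (x≤[t+2]*x t ∣∂ S a′ ∣)

  invariant-beyond : ∀ {a} → n ≤ a → Invariant a
  invariant-beyond {a} n≤a
    rewrite sumOn-empty (S a) cost (S-beyond n≤a) | sumOn-empty (S a) budget (S-beyond n≤a)
          | ∣∂∣-empty (S a) (S-beyond n≤a) = z≤n

  invariant : ∀ d a′ → Checkpoint a′ → n ≤ d + a′ → Invariant a′
  invariant d a′ cp-a′ n≤d+a′ with n ≤? a′
  ... | yes n≤a′ = invariant-beyond n≤a′
  invariant zero    a′ cp-a′ n≤a′ | no n≰a′ = ⊥-elim (n≰a′ n≤a′)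
  invariant (suc d) a′ cp-a′ n≤1+d+a′ | no n≰a′ with nextCheckpoint a′ (≰⇒> n≰a′)
  ... | a , cp-a , a′<a , gap = Block.Accounting.invariant-step a′ a cp-a′ cp-a a′<a gap (≰⇒> n≰a′)
          (invariant d a cp-a (≤-trans n≤1+d+a′ (≤-trans (≤-reflexive (sym (+-suc d a′))) (+-monoʳ-≤ d a′<a))))

  Σcost≤ : sumFin cost ≤ (t + 2) * sumFin (λ w → ∣∂ S (pos w) ∣)
  Σcost≤ = begin
    sumFin cost                         ≡⟨ sym (sumOn-full (S 0) cost S0-full) ⟩
    sumOn (S 0) cost                    ≤⟨ m≤m+n (sumOn (S 0) cost) ∣∂ S 0 ∣ ⟩
    sumOn (S 0) cost + ∣∂ S 0 ∣         ≤⟨ invariant n 0 checkpoint-0 (≤-reflexive (sym (+-identityʳ n))) ⟩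
    sumOn (S 0) budget                  ≡⟨ sumOn-full (S 0) budget S0-full ⟩
    sumFin budget                       ≡⟨ sumFin-*ˡ (t + 2) (λ w → ∣∂ S (pos w) ∣) ⟩
    (t + 2) * sumFin (λ w → ∣∂ S (pos w) ∣) ∎
    where
    open ≤-Reasoning
    S0-full : ∀ w → S 0 w ≡ true
    S0-full w = ⌊⌋-true (0 ≤? pos w) z≤n

  depth : ∀ w → t * suc (cost w) ≤ (t + 2) * k
  depth w with nextCheckpoint (prev w) (prev<n w)
  ... | a , cp-a , prev<a , gap = begin
    t * suc (cost w)                                     ≤⟨ *-monoʳ-≤ t (s≤s (cost≤ w w∈B)) ⟩
    t * suc (∣∂ S a ∣ + (∣∂ S (prev w) ∣ + ∣∂ before π w ∣))
                                                         ≡⟨ distribute t ∣∂ S a ∣ ∣∂ S (prev w) ∣ ∣∂ before π w ∣ ⟩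
    t * ∣∂ S a ∣ + (t * ∣∂ S (prev w) ∣ + t * suc ∣∂ before π w ∣)
                                                         ≤⟨ +-mono-≤ cp-a (+-mono-≤ (prev-checkpoint w) (*-monoʳ-≤ t (π-bound w))) ⟩
    k + (k + t * k)                                      ≡⟨ x+[x+t*x]≡[t+2]*x t k ⟩
    (t + 2) * k                                          ∎
    where
    open ≤-Reasoning
    open Block (prev w) a (prev-checkpoint w) cp-a prev<a gap
    w∈B : InBlock w
    w∈B = prev≤pos w , ≰⇒> λ a≤w → <-irrefl refl (<-≤-trans prev<a (prev-maximal w a a≤w cp-a))
    distribute : ∀ t x y z → t * suc (x + (y + z)) ≡ t * x + (t * y + t * suc z)
    distribute = solve-∀

theorem4 : ∀ {n} (G : Graph n) (p1 q t : ℕ) →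
    IsPathwidthPlusOne G p1 → IsProfile G q → 1 ≤ t → t ≤ p1 →
    ∃ λ (m : ℕ) → Σ (Graph m) λ G' → Σ (Fin n → Fin m) λ ι →
      IsSupergraphVia G G' ι × Σ (IntervalRep m) λ I' →
        Represents I' G' × Canonical I' ×
        (∀ (x : ℚ) → t * mult I' x ≤ (t + 2) * p1) ×
        icost I' ≤ (t + 2) * q
theorem4 {n} G p1 q t ((D , width) , _) ((f , (f-injective , _) , prof≡q) , _) _ _ =
  n , G′ , (λ v → v) , supergraph , I , represents , canonical , mult-bounded t depth , icost≤
  where
  pos : Fin n → ℕ
  pos = toℕ ∘ f
  pos-injective : ∀ u v → pos u ≡ pos v → u ≡ v
  pos-injective u v eq = f-injective (toℕ-injective eq)
  open FirstBagOrder D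
  open CheckpointOrder G π π-injective (len D * n) π< p1 (suc-∣∂before∣≤width width)
                       pos (toℕ<n ∘ f) pos-injective t
  open IntervalModel G τ τ-injective
  icost≤ : icost I ≤ (t + 2) * q
  icost≤ = begin
    icost I                                        ≤⟨ icost-bounded ⟩
    sumFin cost                                    ≤⟨ Σcost≤ ⟩
    (t + 2) * sumFin (λ w → Boundary.∣∂_∣ G (S (pos w)))  ≤⟨ *-monoʳ-≤ (t + 2) (Σ∣∂suffix∣≤profile G f f-injective) ⟩
    (t + 2) * profOf G f                           ≡⟨ cong ((t + 2) *_) prof≡q ⟩
    (t + 2) * q                                    ∎
    where open ≤-Reasoning
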